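{- There is an absolute constant \(c\) such that for every \(\sigma\in\{\text{arrow},\text{chair},\text{X}\}\) and every instance \(I\) of 3-Partition (with \(m\) and \(B\) even), the graph \(G_I\) constructed from \(I\) and \(\sigma\) has pathwidth at most \(c\).
   Context: Pathwidth is the minimum width of a path decomposition. A 3-Partition instance \(I\) consists of a set \(A\) of \(3m\) elements (\(m\ge3\)), \(B\in\mathbb{N}\), and sizes \(s(a)\in\mathbb{N}\) with \(\sum_{a\in A}s(a)=mB\). A fence between \(u\) and \(v\) (ordered) consists of \(u,v\), new vertices \(w_1,w_2,w_3\), the single edges \(uw_2, vw_1\), for each of the other eight pairs \(xy\) of \(\{u,v,w_1,w_2,w_3\}\) 12 paths \(xzy\) with distinct new middle vertices, plus direct edges depending on \(\sigma\): for arrow both \(uv\) and \(uw_1\); for X none; for chair exactly one of \(uv\), \(uw_1\) (prescribed below for radian fences, an arbitrary choice otherwise). All fences use fresh internal vertices. The graph \(G_I\): a transmitter wheel with center \(c_T\), rim cycle \(t_1\dots t_{3m}\) (rim edges \(t_it_{i+1}\), indices mod \(3m\)) and a fence from \(u=c_T\) to \(v=t_i\) for each \(i\); a collector wheel with center \(c_C\), rim cycle \(r_1\dots r_{Bm}\) (rim edges \(r_jr_{j+1}\), indices mod \(Bm\)) and a fence from \(u=c_C\) to \(v=r_j\) for each \(j\); for \(\sigma=\) chair, the fence to the \(i\)-th rim vertex contains \(uv\) if \(i\) is even and \(uw_1\) if \(i\) is odd. For each \(i=1,\dots,m\), a divider: new vertices \(d_i,d'_i\) and fences between \(t_{3i}\)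 and \(d_i\), between \(d_i\) and \(d'_i\), and between \(d'_i\) and \(r_{Bi}\). For each \(a\in A\), a splitter: new vertices \(q_a\) and \(l_{a,1},\dots,l_{a,s(a)}\), a fence between \(q_a\) and each \(l_{a,j}\), the edge \(q_ac_T\), and the edges \(l_{a,j}c_C\) for all \(j\). -}

module Defs where

open import Data.Nat using (ℕ; zero; suc; _+_; _*_; _∸_; _≤_; _<_; s≤s; z≤n)
open import Data.Nat.Properties using (*-monoʳ-≤; *-suc; +-comm; +-suc; ≤-trans; ≤-reflexive)
open import Data.Fin using (Fin; toℕ; fromℕ<) renaming (_≤_ to _≤ᶠ_)
open import Data.Fin.Properties using (toℕ<n)
open import Data.Bool using (Bool; true; false; not)
open import Data.List using (List; length; map; allFin)
open import Data.Nat.ListAction using (sum)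
open import Data.List.Membership.Propositional using (_∈_)
open import Data.Product using (_×_; _,_; proj₁; proj₂; ∃-syntax)
open import Data.Sum using (_⊎_)
open import Relation.Binary.PropositionalEquality using (_≡_; sym; trans; cong)

-- A graph is a vertex type V with an edge relation E (read symmetrically:
-- E x y is an edge between x and y).
record PathDecomposition (V : Set) (E : V → V → Set) : Set where
  field
    len      : ℕ
    bag      : Fin len → List V
    covers   : ∀ v → ∃[ i ] (v ∈ bag i)
    edgeIn   : ∀ x y → E x y → ∃[ i ] (x ∈ bag i × y ∈ bag i)
    interval : ∀ v (i j k : Fin len) → i ≤ᶠ j → j ≤ᶠ k →
               v ∈ bag i → v ∈ bag k → v ∈ bag j

-- width = max bag size − 1; "width ≤ c" means every bag has ≤ c+1 entries
WidthAtMost : ∀ {V E} → PathDecomposition V E → ℕ → Set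
WidthAtMost P c = ∀ i → length (PathDecomposition.bag P i) ≤ suc c

PathwidthAtMost : (V : Set) → (V → V → Set) → ℕ → Set
PathwidthAtMost V E c = ∃[ P ] WidthAtMost {V} {E} P c

record Instance : Set where
  field
    m     : ℕ
    B     : ℕ
    s     : Fin (3 * m) → ℕ
    m≥3   : 3 ≤ m
    B≥1   : 1 ≤ B          -- needed for r_{Bi} to exist
    total : sum (map s (allFin (3 * m))) ≡ m * B

data Shape : Set where
  arrow chair X : Shape

data FV : Set where
  fu fv fw1 fw2 fw3 : FV

-- the eight pairs other than {u,w2} and {v,w1}
data Pair : Set where
  p-uv p-uw1 p-uw3 p-vw2 p-vw3 p-w1w2 p-w1w3 p-w2w3 : Pair

ends : Pair → FV × FV
ends p-uv   = fu , fv
ends p-uw1  = fu , fw1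
ends p-uw3  = fu , fw3
ends p-vw2  = fv , fw2
ends p-vw3  = fv , fw3
ends p-w1w2 = fw1 , fw2
ends p-w1w3 = fw1 , fw3
ends p-w2w3 = fw2 , fw3

-- internal (fresh) vertices of a fence: w1,w2,w3 and 8·12 path middles
data FInt : Set where
  iw1 iw2 iw3 : FInt
  imid        : Pair → Fin 12 → FInt

data FLoc : Set where
  lu lv : FLoc
  lin   : FInt → FLoc

pt : FV → FLoc
pt fu  = lu
pt fv  = lv
pt fw1 = lin iw1
pt fw2 = lin iw2
pt fw3 = lin iw3

-- edges of a fence of shape σ; the Bool is the chair choice
-- (true = the edge uv, false = the edge uw1); irrelevant unless σ = chair
data FenceEdge : Shape → Bool → FLoc → FLoc → Set where
  e-uw2    : ∀ {σ b} → FenceEdge σ b lu (lin iw2)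
  e-vw1    : ∀ {σ b} → FenceEdge σ b lv (lin iw1)
  e-path₁  : ∀ {σ b} (p : Pair) (k : Fin 12) →
             FenceEdge σ b (pt (proj₁ (ends p))) (lin (imid p k))
  e-path₂  : ∀ {σ b} (p : Pair) (k : Fin 12) →
             FenceEdge σ b (lin (imid p k)) (pt (proj₂ (ends p)))
  arrow-uv  : ∀ {b} → FenceEdge arrow b lu lv
  arrow-uw1 : ∀ {b} → FenceEdge arrow b lu (lin iw1)
  chair-uv  : FenceEdge chair true lu lv
  chair-uw1 : FenceEdge chair false lu (lin iw1)

-- Index helpers (all rim indices are 0-based: t k stands for t_{k+1})

-- 0-based index of t_{3i} for 1-based i = toℕ i + 1, namely 3·toℕ i + 2
idx3 : ∀ {m} → Fin m → Fin (3 * m)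
idx3 {m} i = fromℕ< {3 * toℕ i + 2} bound
  where
  eq : suc (3 * toℕ i + 2) ≡ 3 * suc (toℕ i)
  eq = trans (sym (+-suc (3 * toℕ i) 2))
       (trans (+-comm (3 * toℕ i) 3) (sym (*-suc 3 (toℕ i))))
  bound : 3 * toℕ i + 2 < 3 * m
  bound = ≤-trans (≤-reflexive eq) (*-monoʳ-≤ 3 (toℕ<n i))

-- 0-based index of r_{Bi} for 1-based i = toℕ i + 1, namely B·toℕ i + (B−1)
idxB : ∀ {m} (B : ℕ) → 1 ≤ B → Fin m → Fin (B * m)
idxB {m} (suc b) _ i = fromℕ< {suc b * toℕ i + b} bound
  where
  eq : suc (suc b * toℕ i + b) ≡ suc b * suc (toℕ i)
  eq = trans (sym (+-suc (suc b * toℕ i) b))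
       (trans (+-comm (suc b * toℕ i) (suc b)) (sym (*-suc (suc b) (toℕ i))))
  bound : suc b * toℕ i + b < suc b * m
  bound = ≤-trans (≤-reflexive eq) (*-monoʳ-≤ (suc b) (toℕ<n i))

CycSucc : (n : ℕ) → Fin n → Fin n → Set
CycSucc n j k = (toℕ k ≡ suc (toℕ j)) ⊎ (suc (toℕ j) ≡ n × toℕ k ≡ 0)

isOdd : ℕ → Bool
isOdd zero    = false
isOdd (suc n) = not (isOdd n)

module _ (I : Instance) where
  open Instance I

  data DivPart : Set where
    dv₁ dv₂ dv₃ : DivPart

  data FenceId : Set where
    ftr  : Fin (3 * m) → FenceId
    fco  : Fin (B * m) → FenceId
    fdiv : Fin m → DivPart → FenceId
    fspl : (a : Fin (3 * m)) → Fin (s a) → FenceId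

  data Vtx : Set where
    cT cC : Vtx
    t     : Fin (3 * m) → Vtx
    r     : Fin (B * m) → Vtx
    d d'  : Fin m → Vtx
    q     : Fin (3 * m) → Vtx
    l     : (a : Fin (3 * m)) → Fin (s a) → Vtx
    fin   : FenceId → FInt → Vtx

  fenceEnds : FenceId → Vtx × Vtx
  fenceEnds (ftr k)      = cT , t k
  fenceEnds (fco k)      = cC , r k
  fenceEnds (fdiv i dv₁) = t (idx3 i) , d i
  fenceEnds (fdiv i dv₂) = d i , d' i
  fenceEnds (fdiv i dv₃) = d' i , r (idxB B B≥1 i)
  fenceEnds (fspl a j)   = q a , l a j

  emb : FenceId → FLoc → Vtx
  emb f lu      = proj₁ (fenceEnds f)
  emb f lv      = proj₂ (fenceEnds f)
  emb f (lin z) = fin f z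

  -- chair choice of each fence (true = uv, false = uw1): prescribed for
  -- radian fences (the i-th rim vertex, i = k+1, gets uv iff i is even,
  -- i.e. iff k is odd), given by `ch` for all other fences
  chairBit : (FenceId → Bool) → FenceId → Bool
  chairBit ch (ftr k) = isOdd (toℕ k)
  chairBit ch (fco k) = isOdd (toℕ k)
  chairBit ch f       = ch f

  data GE (σ : Shape) (ch : FenceId → Bool) : Vtx → Vtx → Set where
    rimT  : ∀ j k → CycSucc (3 * m) j k → GE σ ch (t j) (t k)
    rimC  : ∀ j k → CycSucc (B * m) j k → GE σ ch (r j) (r k)
    q-cT  : ∀ a → GE σ ch (q a) cT
    l-cC  : ∀ a j → GE σ ch (l a j) cC
    fence : ∀ f x y → FenceEdge σ (chairBit ch f) x y →
            GE σ ch (emb f x) (emb f y)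

-- Lay the vertices of G_I out on a line of 3m
-- blocks of W = B + Σ s(a) + 1 positions and give each vertex an interval of positions, so that
-- adjacent vertices have overlapping intervals; the bags "all vertices whose interval contains p"
-- then form a path decomposition.  The centres c_T, c_C and the rim vertices t₀, r₀ closing the
-- two cycles lie in every bag.  Block x holds the fence c_T–t_x and the whole splitter of the
-- x-th element of A (q_x over the block, one fence q_x–l_{x,j} per position after offset B), and
-- each t_{x+1} spans blocks x and x+1.  Block 3i+2 also carries the collector rim from r_{Bi} to
-- r_{B(i+1)}, one rim vertex and its fence per position, and divider i sits at offset B, where
-- t_{3i+2} and r_{Bi+B−1} are both present.  Every fence lives at a single position, so each
-- bag has at most 608 vertices.

module Submission where

open import Defs
open import Data.Bool using (Bool)
open import Data.Empty using (⊥-elim)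
open import Data.Fin using (Fin; toℕ; fromℕ<)
open import Data.Fin.Properties using (toℕ<n; toℕ-fromℕ<; fromℕ<-toℕ; toℕ-injective)
open import Data.List using (List; []; _∷_; _++_; map; length; filter; allFin; cartesianProductWith)
open import Data.List.Membership.Propositional using (_∈_)
open import Data.List.Membership.Propositional.Properties
  using (∈-filter⁺; ∈-filter⁻; ∈-map⁺; ∈-++⁺ˡ; ∈-++⁺ʳ; ∈-cartesianProductWith⁺; ∈-allFin)
open import Data.List.Properties using (length-filter)
open import Data.List.Relation.Unary.Any using (here; there)
open import Data.Nat
  using (ℕ; zero; suc; _+_; _*_; _∸_; _≤_; _<_; s≤s; s≤s⁻¹; z≤n; NonZero; >-nonZero; _≤?_; _<?_; _≟_)
open import Data.Nat.Divisibility using (_∣_)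
open import Data.Nat.DivMod
  using (_/_; _%_; _mod_; m≡m%n+[m/n]*n; m%n<n; m<n⇒m%n≡m; m<n⇒m/n≡0; m*n/n≡m; m*n%n≡0;
         +-distrib-/; [m+kn]%n≡m%n; /-monoˡ-≤; m<n*o⇒m/o<n)
open import Data.Nat.ListAction using (sum)
open import Data.Nat.Properties
open import Data.Nat.Tactic.RingSolver using (solve-∀)
open import Data.Product using (_×_; _,_; proj₁; proj₂; ∃-syntax)
open import Data.Sum using (_⊎_; inj₁; inj₂)
open import Data.Unit using (⊤; tt)
open import Relation.Nullary using (Dec; yes; no)
open import Relation.Nullary.Decidable using (_×-dec_)
open import Relation.Binary.PropositionalEquality using (_≡_; refl; sym; trans; cong; cong₂; subst; subst₂)

module _ (n : ℕ) .{{_ : NonZero n}} where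

  divMod-unique : ∀ k ρ → ρ < n → ((n * k + ρ) / n ≡ k) × ((n * k + ρ) % n ≡ ρ)
  divMod-unique k ρ ρ<n = subst (λ z → (z / n ≡ k) × (z % n ≡ ρ)) (sym swap) (quot , rem)
    where
    swap : n * k + ρ ≡ ρ + k * n
    swap = trans (+-comm (n * k) ρ) (cong (ρ +_) (*-comm n k))
    carry-free : ρ % n + (k * n) % n < n
    carry-free = subst₂ (λ a b → a + b < n) (sym (m<n⇒m%n≡m ρ<n)) (sym (m*n%n≡0 k n))
                   (subst (_< n) (sym (+-identityʳ ρ)) ρ<n)
    quot : (ρ + k * n) / n ≡ k
    quot = trans (+-distrib-/ ρ (k * n) carry-free) (cong₂ _+_ (m<n⇒m/n≡0 ρ<n) (m*n/n≡m k n))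
    rem : (ρ + k * n) % n ≡ ρ
    rem = trans ([m+kn]%n≡m%n ρ k n) (m<n⇒m%n≡m ρ<n)

  quotient-lower : ∀ k p → n * k ≤ p → k ≤ p / n
  quotient-lower k p le = subst (_≤ p / n) (trans (cong (_/ n) (*-comm n k)) (m*n/n≡m k n)) (/-monoˡ-≤ n le)

  quotient-upper : ∀ k c p → p ≤ n * k + c → c < n → p / n ≤ k
  quotient-upper k c p le c<n = ≤-trans (/-monoˡ-≤ n le) (≤-reflexive (proj₁ (divMod-unique k c c<n)))

  quotient-window : ∀ k c p → n * k ≤ p → p ≤ n * k + c → c < n → p / n ≡ k
  quotient-window k c p lo hi c<n = ≤-antisym (quotient-upper k c p hi c<n) (quotient-lower k p lo)

  divMod-window : ∀ k a b p → n * k + a ≤ p → p ≤ n * k + b → b < n →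
           (p / n ≡ k) × (a ≤ p % n × p % n ≤ b)
  divMod-window k a b p lo hi b<n = subst (λ z → (z / n ≡ k) × (a ≤ z % n × z % n ≤ b)) split
      (proj₁ dm , subst (a ≤_) (sym (proj₂ dm)) a≤y , subst (_≤ b) (sym (proj₂ dm)) y≤b)
    where
    y = p ∸ n * k
    split : n * k + y ≡ p
    split = m+[n∸m]≡n (≤-trans (m≤m+n (n * k) a) lo)
    a≤y : a ≤ y
    a≤y = +-cancelˡ-≤ (n * k) a y (subst (n * k + a ≤_) (sym split) lo)
    y≤b : y ≤ b
    y≤b = +-cancelˡ-≤ (n * k) y b (subst (_≤ n * k + b) (sym split) hi)
    dm = divMod-unique k y (≤-<-trans y≤b b<n)

  quotient-adjacent : ∀ k c p → n * k ≤ p → p ≤ n * suc k + c → c < n → p / n ≡ k ⊎ p / n ≡ suc k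
  quotient-adjacent k c p lo hi c<n with m≤n⇒m<n∨m≡n (quotient-upper (suc k) c p hi c<n)
  ... | inj₂ eq = inj₂ eq
  ... | inj₁ lt = inj₁ (≤-antisym (s≤s⁻¹ lt) (quotient-lower k p lo))

  mod-toℕ : ∀ {k : Fin n} {x} → x ≡ toℕ k → x mod n ≡ k
  mod-toℕ {k} refl = toℕ-injective (trans (toℕ-fromℕ< _) (m<n⇒m%n≡m (toℕ<n k)))

B*i+B≡B*[1+i]+0 : ∀ b i → b * i + b ≡ b * suc i + 0
B*i+B≡B*[1+i]+0 = solve-∀

b*0+0≡0 : ∀ b → b * 0 + 0 ≡ 0
b*0+0≡0 = solve-∀

1+[3*i+2]≡3*[1+i] : ∀ i → suc (3 * i + 2) ≡ 3 * suc i
1+[3*i+2]≡3*[1+i] = solve-∀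

1+[w*x+l]≡w*[1+x] : ∀ l x → suc (suc l * x + l) ≡ suc l * suc x
1+[w*x+l]≡w*[1+x] = solve-∀

∈⇒≤sum : ∀ {x xs} → x ∈ xs → x ≤ sum xs
∈⇒≤sum {xs = x ∷ xs} (here refl) = m≤m+n x (sum xs)
∈⇒≤sum {xs = y ∷ xs} (there x∈xs) = ≤-trans (∈⇒≤sum x∈xs) (m≤n+m (sum xs) y)

idxB-toℕ : ∀ {m} b (b≥1 : 1 ≤ b) (i : Fin m) → toℕ (idxB b b≥1 i) ≡ b * toℕ i + (b ∸ 1)
idxB-toℕ (suc b) _ i = toℕ-fromℕ< _

data Range : Set where
  everywhere : Range
  [_,_]      : ℕ → ℕ → Range

point : ℕ → Range
point p = [ p , p ]

infix 4 _∋_ _∋?_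

_∋_ : Range → ℕ → Set
everywhere  ∋ p = ⊤
[ a , b ]   ∋ p = a ≤ p × p ≤ b

_∋?_ : ∀ R p → Dec (R ∋ p)
everywhere ∋? p = yes tt
[ a , b ]  ∋? p = (a ≤? p) ×-dec (p ≤? b)

∋-convex : ∀ R {a b c} → R ∋ a → R ∋ c → a ≤ b → b ≤ c → R ∋ b
∋-convex everywhere _ _ _ _ = tt
∋-convex [ _ , _ ] (lo , _) (_ , hi) a≤b b≤c = ≤-trans lo a≤b , ≤-trans b≤c hi

-- V need not be finite: candidates p lists (a superset of) the vertices whose range contains p.
record IntervalModel (V : Set) (E : V → V → Set) : Set where
  field
    extent     : ℕ
    range      : V → Range
    home       : V → ℕ
    home<      : ∀ v → home v < extent
    range-home : ∀ v → range v ∋ home v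
    meet       : ∀ x y → E x y → ∃[ p ] (p < extent × range x ∋ p × range y ∋ p)
    candidates : ℕ → List V
    candidates-complete : ∀ v p → range v ∋ p → v ∈ candidates p

  bagAt : ℕ → List V
  bagAt p = filter (λ v → range v ∋? p) (candidates p)

  ∈-bagAt : ∀ {v p} → range v ∋ p → v ∈ bagAt p
  ∈-bagAt {v} {p} h = ∈-filter⁺ (λ v → range v ∋? p) (candidates-complete v p h) h

  ∈-bagAt⁻ : ∀ {v p} → v ∈ bagAt p → range v ∋ p
  ∈-bagAt⁻ {p = p} h = proj₂ (∈-filter⁻ (λ v → range v ∋? p) {xs = candidates p} h)

  bagsAt : ∀ x y p → p < extent → range x ∋ p → range y ∋ p →
           ∃[ i ] (x ∈ bagAt (toℕ {extent} i) × y ∈ bagAt (toℕ i))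
  bagsAt x y p p< hx hy = fromℕ< p< , subst (λ n → x ∈ bagAt n × y ∈ bagAt n) (sym (toℕ-fromℕ< p<))
                                        (∈-bagAt hx , ∈-bagAt hy)

  pathDecomposition : PathDecomposition V E
  pathDecomposition = record
    { len      = extent
    ; bag      = λ i → bagAt (toℕ i)
    ; covers   = λ v → let (i , v∈ , _) = bagsAt v v (home v) (home< v) (range-home v) (range-home v)
                       in i , v∈
    ; edgeIn   = λ x y e → let (p , p< , hx , hy) = meet x y e in bagsAt x y p p< hx hy
    ; interval = λ v i j k i≤j j≤k v∈i v∈k →
                   ∈-bagAt (∋-convex (range v) (∈-bagAt⁻ v∈i) (∈-bagAt⁻ v∈k) i≤j j≤k)
    }

  pathDecomposition-width : ∀ c → (∀ p → length (candidates p) ≤ suc c) →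
                            WidthAtMost pathDecomposition c
  pathDecomposition-width c bound i =
    ≤-trans (length-filter (λ v → range v ∋? toℕ i) (candidates (toℕ i))) (bound (toℕ i))

allPairs : List Pair
allPairs = p-uv ∷ p-uw1 ∷ p-uw3 ∷ p-vw2 ∷ p-vw3 ∷ p-w1w2 ∷ p-w1w3 ∷ p-w2w3 ∷ []

∈-allPairs : ∀ p → p ∈ allPairs
∈-allPairs p-uv   = here refl
∈-allPairs p-uw1  = there (here refl)
∈-allPairs p-uw3  = there (there (here refl))
∈-allPairs p-vw2  = there (there (there (here refl)))
∈-allPairs p-vw3  = there (there (there (there (here refl))))
∈-allPairs p-w1w2 = there (there (there (there (there (here refl)))))
∈-allPairs p-w1w3 = there (there (there (there (there (there (here refl))))))
∈-allPairs p-w2w3 = there (there (there (there (there (there (there (here refl)))))))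

allFInt : List FInt
allFInt = iw1 ∷ iw2 ∷ iw3 ∷ cartesianProductWith imid allPairs (allFin 12)

∈-allFInt : ∀ z → z ∈ allFInt
∈-allFInt iw1        = here refl
∈-allFInt iw2        = there (here refl)
∈-allFInt iw3        = there (there (here refl))
∈-allFInt (imid p k) = there (there (there (∈-cartesianProductWith⁺ imid (∈-allPairs p) (∈-allFin k))))

module Layout (I : Instance) where
  open Instance I

  instance
    B≢0 : NonZero B
    B≢0 = >-nonZero B≥1
    m≢0 : NonZero m
    m≢0 = >-nonZero (≤-trans (s≤s z≤n) m≥3)
    3m≢0 : NonZero (3 * m)
    3m≢0 = m*n≢0 3 m
    Bm≢0 : NonZero (B * m)
    Bm≢0 = m*n≢0 B m

  S : ℕ
  S = sum (map s (allFin (3 * m)))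

  s≤S : ∀ a → s a ≤ S
  s≤S a = ∈⇒≤sum (∈-map⁺ s (∈-allFin a))

  last : ℕ
  last = B + S

  W : ℕ
  W = suc last

  B≤last : B ≤ last
  B≤last = m≤m+n B S

  pos : ℕ → ℕ → ℕ
  pos x y = W * x + y

  extent : ℕ
  extent = W * (3 * m)

  dividerBlock : ℕ → ℕ
  dividerBlock i = 3 * i + 2

  dividerBlock-mono : ∀ i → dividerBlock i ≤ dividerBlock (suc i)
  dividerBlock-mono i = +-monoˡ-≤ 2 (*-monoʳ-≤ 3 (n≤1+n i))

  dividerBlock/3 : ∀ {x i} → x ≡ dividerBlock i → x / 3 ≡ i
  dividerBlock/3 {i = i} refl = proj₁ (divMod-unique 3 i 2 (s≤s (s≤s (s≤s z≤n))))

  collectorSlot : ℕ → ℕ → ℕ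
  collectorSlot i ρ = pos (dividerBlock i) (suc ρ)

  dividerSlot : ℕ → ℕ
  dividerSlot i = pos (dividerBlock i) B

  splitterSlot : ℕ → ℕ → ℕ
  splitterSlot a j = pos a (suc B + j)

  slot : FenceId I → ℕ
  slot (ftr k)    = W * toℕ k
  slot (fco k)    = collectorSlot (toℕ k / B) (toℕ k % B)
  slot (fdiv i _) = dividerSlot (toℕ i)
  slot (fspl a j) = splitterSlot (toℕ a) (toℕ j)

  transmitterRange : ℕ → Range
  transmitterRange zero    = everywhere
  transmitterRange (suc K) = [ W * K , pos (suc K) last ]

  -- The range of r_{Bi+ρ}: for ρ > 0 offsets ρ and ρ+1 of block 3i+2; r_{Bi} covers blocks
  -- 3i−1 … 3i+2, and r₀ is everywhere.
  collectorRange : ℕ → ℕ → Range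
  collectorRange i       (suc j) = [ collectorSlot i j , collectorSlot i (suc j) ]
  collectorRange zero    zero    = everywhere
  collectorRange (suc i) zero    = [ W * dividerBlock i , pos (dividerBlock (suc i)) last ]

  range : Vtx I → Range
  range cT        = everywhere
  range cC        = everywhere
  range (t k)     = transmitterRange (toℕ k)
  range (r k)     = collectorRange (toℕ k / B) (toℕ k % B)
  range (q a)     = [ W * toℕ a , pos (toℕ a) last ]
  range (d i)     = point (dividerSlot (toℕ i))
  range (d' i)    = point (dividerSlot (toℕ i))
  range (l a j)   = point (slot (fspl a j))
  range (fin f _) = point (slot f)

  home : Vtx I → ℕ
  home cT        = 0
  home cC        = 0
  home (t k)     = slot (ftr k)
  home (r k)     = slot (fco k)
  home (q a)     = W * toℕ a
  home (d i)     = dividerSlot (toℕ i)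
  home (d' i)    = dividerSlot (toℕ i)
  home (l a j)   = slot (fspl a j)
  home (fin f _) = slot f

  tAt : ℕ → Vtx I
  tAt x = t (x mod (3 * m))

  rAt : ℕ → Vtx I
  rAt x = r (x mod (B * m))

  interior : FenceId I → List (Vtx I)
  interior f = map (fin f) allFInt

  ∈-interior : ∀ f z → fin f z ∈ interior f
  ∈-interior f z = ∈-map⁺ (fin f) (∈-allFInt z)

  centres : List (Vtx I)
  centres = cT ∷ cC ∷ tAt 0 ∷ rAt 0 ∷ []

  transmitterPart : ℕ → List (Vtx I)
  transmitterPart x = tAt x ∷ tAt (suc x) ∷ q (x mod (3 * m)) ∷ interior (ftr (x mod (3 * m)))

  collectorPart : ℕ → ℕ → List (Vtx I)
  collectorPart i y = rAt (B * i) ∷ rAt (B * i + B) ∷ rAt (B * i + y) ∷ rAt (B * i + (y ∸ 1)) ∷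
                      interior (fco ((B * i + (y ∸ 1)) mod (B * m)))

  dividerPart : ℕ → List (Vtx I)
  dividerPart i = d (i mod m) ∷ d' (i mod m) ∷
                  interior (fdiv (i mod m) dv₁) ++ interior (fdiv (i mod m) dv₂) ++ interior (fdiv (i mod m) dv₃)

  splitterPart : (a : Fin (3 * m)) → ℕ → List (Vtx I)
  splitterPart a j with j <? s a
  ... | yes j<s = l a (fromℕ< j<s) ∷ interior (fspl a (fromℕ< j<s))
  ... | no _    = []

  -- The candidates at offset y of block x; entries built from offsets that host nothing (such as
  -- y ∸ suc B for y ≤ B) are junk, later removed by the range filter.
  candidatesAt : ℕ → ℕ → List (Vtx I)
  candidatesAt x y = centres ++ transmitterPart x ++ collectorPart (x / 3) y ++ dividerPart (x / 3) ++
                     splitterPart (x mod (3 * m)) (y ∸ suc B)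

  candidates : ℕ → List (Vtx I)
  candidates p = candidatesAt (p / W) (p % W)

  length-splitterPart : ∀ a j → length (splitterPart a j) ≤ 100
  length-splitterPart a j with j <? s a
  ... | yes _ = ≤-refl
  ... | no _  = z≤n

  length-candidates : ∀ p → length (candidates p) ≤ 608
  length-candidates p = +-monoʳ-≤ 508 (length-splitterPart (p / W mod (3 * m)) (p % W ∸ suc B))

  module _ {x y : ℕ} {v : Vtx I} where
    via-transmitter : v ∈ transmitterPart x → v ∈ candidatesAt x y
    via-transmitter h = ∈-++⁺ʳ centres (∈-++⁺ˡ h)

    via-collector : v ∈ collectorPart (x / 3) y → v ∈ candidatesAt x y
    via-collector h = ∈-++⁺ʳ centres (∈-++⁺ʳ (transmitterPart x) (∈-++⁺ˡ h))

    via-divider : v ∈ dividerPart (x / 3) → v ∈ candidatesAt x y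
    via-divider h =
      ∈-++⁺ʳ centres (∈-++⁺ʳ (transmitterPart x) (∈-++⁺ʳ (collectorPart (x / 3) y) (∈-++⁺ˡ h)))

    via-splitter : v ∈ splitterPart (x mod (3 * m)) (y ∸ suc B) → v ∈ candidatesAt x y
    via-splitter h = ∈-++⁺ʳ centres (∈-++⁺ʳ (transmitterPart x) (∈-++⁺ʳ (collectorPart (x / 3) y)
                       (∈-++⁺ʳ (dividerPart (x / 3)) h)))

  tAt≡ : ∀ {x k} → x ≡ toℕ k → t k ≡ tAt x
  tAt≡ e = cong t (sym (mod-toℕ (3 * m) e))

  rAt≡ : ∀ {x k} → x ≡ toℕ k → r k ≡ rAt x
  rAt≡ e = cong r (sym (mod-toℕ (B * m) e))

  ∈-interior-at : ∀ {f f'} z → f ≡ f' → fin f z ∈ interior f'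
  ∈-interior-at {f} z refl = ∈-interior f z

  pos-divMod : ∀ x y → y ≤ last → (pos x y / W ≡ x) × (pos x y % W ≡ y)
  pos-divMod x y y≤last = divMod-unique W x y (s≤s y≤last)

  [W*x]/W≡x : ∀ x → W * x / W ≡ x
  [W*x]/W≡x x = quotient-window W x 0 (W * x) ≤-refl (m≤m+n (W * x) 0) (s≤s z≤n)

  collectorIndex : ∀ (k : Fin (B * m)) → toℕ k ≡ B * (toℕ k / B) + toℕ k % B
  collectorIndex k = trans (m≡m%n+[m/n]*n (toℕ k) B)
                       (trans (+-comm (toℕ k % B) _) (cong (_+ toℕ k % B) (*-comm (toℕ k / B) B)))

  ∈-splitterPart : ∀ a (j : Fin (s a)) →
                   l a j ∈ splitterPart a (toℕ j) × (∀ z → fin (fspl a j) z ∈ splitterPart a (toℕ j))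
  ∈-splitterPart a j with toℕ j <? s a
  ... | yes j<s rewrite fromℕ<-toℕ j j<s = here refl , λ z → there (∈-interior (fspl a j) z)
  ... | no j≮s  = ⊥-elim (j≮s (toℕ<n j))

  t∈candidates : ∀ k K p → toℕ k ≡ K → transmitterRange K ∋ p → t k ∈ candidates p
  t∈candidates k zero    p k≡0 _ = there (there (here (tAt≡ (sym k≡0))))
  t∈candidates k (suc K) p k≡ (lo , hi) with quotient-adjacent W K last p lo hi ≤-refl
  ... | inj₁ x≡K  = via-transmitter (there (here (tAt≡ (trans (cong suc x≡K) (sym k≡)))))
  ... | inj₂ x≡sK = via-transmitter (here (tAt≡ (trans x≡sK (sym k≡))))

  r∈candidates : ∀ k i ρ p → toℕ k ≡ B * i + ρ → ρ < B → collectorRange i ρ ∋ p → r k ∈ candidates p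
  r∈candidates k zero zero p k≡ _ _ =
    there (there (there (here (rAt≡ (sym (trans k≡ (b*0+0≡0 B)))))))
  r∈candidates k (suc i) zero p k≡ _ (lo , hi)
    with m≤n⇒m<n∨m≡n (quotient-lower W (dividerBlock i) p lo)
  ... | inj₂ db≡x = via-collector (there (here (rAt≡ (trans (cong (λ j → B * j + B) (dividerBlock/3 (sym db≡x)))
                                                           (trans (B*i+B≡B*[1+i]+0 B i) (sym k≡))))))
  ... | inj₁ db<x = via-collector (here (rAt≡ (trans (cong (B *_) x/3≡1+i) (trans (sym (+-identityʳ _)) (sym k≡)))))
    where
    x/3≡1+i : p / W / 3 ≡ suc i
    x/3≡1+i = quotient-window 3 (suc i) 2 (p / W) (subst (_≤ p / W) (1+[3*i+2]≡3*[1+i] i) db<x)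
                (quotient-upper W (dividerBlock (suc i)) last p hi ≤-refl) (s≤s (s≤s (s≤s z≤n)))
  r∈candidates k i (suc j) p k≡ 1+j<B (lo , hi)
    with divMod-window W (dividerBlock i) (suc j) (suc (suc j)) p lo hi (s≤s (≤-trans 1+j<B B≤last))
  ... | x≡ , y≥ , y≤ with p % W ≟ suc j
  ...   | yes y≡ = via-collector (there (there (here (rAt≡ (trans (cong₂ (λ a b → B * a + b) (dividerBlock/3 x≡) y≡)
                                                                  (sym k≡))))))
  ...   | no y≢  = via-collector (there (there (there (here (rAt≡ (trans (cong₂ (λ a b → B * a + (b ∸ 1))
                                   (dividerBlock/3 x≡) y≡2+j) (sym k≡)))))))
    where
    y≡2+j : p % W ≡ suc (suc j)
    y≡2+j = ≤-antisym y≤ (≤∧≢⇒< y≥ (λ e → y≢ (sym e)))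

  splitterOffset≤last : ∀ a (j : Fin (s a)) → suc B + toℕ j ≤ last
  splitterOffset≤last a j = subst (_≤ last) (+-suc B (toℕ j)) (+-monoʳ-≤ B (≤-trans (toℕ<n j) (s≤S a)))

  dividerSlot-index : ∀ i → dividerSlot (toℕ i) / W / 3 mod m ≡ i
  dividerSlot-index i = mod-toℕ m (dividerBlock/3 (proj₁ (pos-divMod (dividerBlock (toℕ i)) B B≤last)))

  splitterPart⊆candidates-slot : ∀ a j {v} → v ∈ splitterPart a (toℕ j) → v ∈ candidates (slot (fspl a j))
  splitterPart⊆candidates-slot a j {v} h =
    via-splitter (subst₂ (λ a' j' → v ∈ splitterPart a' j') (sym (mod-toℕ (3 * m) x≡)) (sym y∸≡) h)
    where
    x≡ = proj₁ (pos-divMod (toℕ a) (suc B + toℕ j) (splitterOffset≤last a j))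
    y∸≡ : slot (fspl a j) % W ∸ suc B ≡ toℕ j
    y∸≡ = trans (cong (_∸ suc B) (proj₂ (pos-divMod (toℕ a) (suc B + toℕ j) (splitterOffset≤last a j))))
                (m+n∸m≡n (suc B) (toℕ j))

  fin∈candidates-slot : ∀ f z → fin f z ∈ candidates (slot f)
  fin∈candidates-slot (ftr k) z =
    via-transmitter (there (there (there (∈-interior-at z (cong ftr (sym (mod-toℕ (3 * m) ([W*x]/W≡x (toℕ k)))))))))
  fin∈candidates-slot (fco k) z =
    via-collector (there (there (there (there (∈-interior-at z (cong fco (sym (mod-toℕ (B * m) index))))))))
    where
    i = toℕ k / B
    ρ = toℕ k % B
    slot≡ = pos-divMod (dividerBlock i) (suc ρ) (≤-trans (m%n<n (toℕ k) B) B≤last)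
    index : B * (slot (fco k) / W / 3) + (slot (fco k) % W ∸ 1) ≡ toℕ k
    index = trans (cong₂ (λ a b → B * a + (b ∸ 1)) (dividerBlock/3 (proj₁ slot≡)) (proj₂ slot≡))
                  (sym (collectorIndex k))
  fin∈candidates-slot (fdiv i dv₁) z =
    via-divider (there (there (∈-++⁺ˡ (∈-interior-at z (cong (λ i → fdiv i dv₁) (sym (dividerSlot-index i)))))))
  fin∈candidates-slot (fdiv i dv₂) z =
    via-divider (there (there (∈-++⁺ʳ (interior _)
      (∈-++⁺ˡ (∈-interior-at z (cong (λ i → fdiv i dv₂) (sym (dividerSlot-index i))))))))
  fin∈candidates-slot (fdiv i dv₃) z =
    via-divider (there (there (∈-++⁺ʳ (interior _) (∈-++⁺ʳ (interior _)
      (∈-interior-at z (cong (λ i → fdiv i dv₃) (sym (dividerSlot-index i))))))))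
  fin∈candidates-slot (fspl a j) z = splitterPart⊆candidates-slot a j (proj₂ (∈-splitterPart a j) z)

  ∈candidates-point : ∀ {v p} a → v ∈ candidates a → point a ∋ p → v ∈ candidates p
  ∈candidates-point {v} _ h (lo , hi) = subst (λ p → v ∈ candidates p) (≤-antisym lo hi) h

  candidates-complete : ∀ v p → range v ∋ p → v ∈ candidates p
  candidates-complete cT        p _ = here refl
  candidates-complete cC        p _ = there (here refl)
  candidates-complete (t k)     p h = t∈candidates k (toℕ k) p refl h
  candidates-complete (r k)     p h = r∈candidates k _ _ p (collectorIndex k) (m%n<n (toℕ k) B) h
  candidates-complete (q a)     p (lo , hi) =
    via-transmitter (there (there (here (cong q (sym (mod-toℕ (3 * m) (quotient-window W (toℕ a) last p lo hi ≤-refl)))))))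
  candidates-complete (d i)     p h =
    ∈candidates-point (dividerSlot (toℕ i)) (via-divider (here (cong d (sym (dividerSlot-index i))))) h
  candidates-complete (d' i)    p h =
    ∈candidates-point (dividerSlot (toℕ i)) (via-divider (there (here (cong d' (sym (dividerSlot-index i)))))) h
  candidates-complete (l a j)   p h =
    ∈candidates-point (slot (fspl a j)) (splitterPart⊆candidates-slot a j (proj₁ (∈-splitterPart a j))) h
  candidates-complete (fin f z) p h = ∈candidates-point (slot f) (fin∈candidates-slot f z) h

  transmitterRange∋blockStart : ∀ K → transmitterRange K ∋ W * K
  transmitterRange∋blockStart zero    = tt
  transmitterRange∋blockStart (suc K) = *-monoʳ-≤ W (n≤1+n K) , m≤m+n (W * suc K) last

  transmitterRange∋ : ∀ K y → 1 ≤ K → y ≤ last → transmitterRange K ∋ pos K y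
  transmitterRange∋ (suc K) y _ y≤last =
    ≤-trans (*-monoʳ-≤ W (n≤1+n K)) (m≤m+n (W * suc K) y) , +-monoʳ-≤ (W * suc K) y≤last

  collectorRange∋slot : ∀ i ρ → ρ < B → collectorRange i ρ ∋ collectorSlot i ρ
  collectorRange∋slot i       (suc j) _ = +-monoʳ-≤ (W * dividerBlock i) (n≤1+n (suc j)) , ≤-refl
  collectorRange∋slot zero    zero    _ = tt
  collectorRange∋slot (suc i) zero    _ =
    ≤-trans (*-monoʳ-≤ W (dividerBlock-mono i)) (m≤m+n _ 1) ,
    +-monoʳ-≤ (W * dividerBlock (suc i)) (≤-trans B≥1 B≤last)

  range∋home : ∀ v → range v ∋ home v
  range∋home cT        = tt
  range∋home cC        = tt
  range∋home (t k)     = transmitterRange∋blockStart (toℕ k)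
  range∋home (r k)     = collectorRange∋slot (toℕ k / B) (toℕ k % B) (m%n<n (toℕ k) B)
  range∋home (q a)     = ≤-refl , m≤m+n (W * toℕ a) last
  range∋home (d _)     = ≤-refl , ≤-refl
  range∋home (d' _)    = ≤-refl , ≤-refl
  range∋home (l _ _)   = ≤-refl , ≤-refl
  range∋home (fin _ _) = ≤-refl , ≤-refl

  range-r≡collectorRange : ∀ k i ρ → toℕ k ≡ B * i + ρ → ρ < B → range (r k) ≡ collectorRange i ρ
  range-r≡collectorRange k i ρ k≡ ρ<B =
    cong₂ collectorRange (trans (cong (_/ B) k≡) (proj₁ dm)) (trans (cong (_% B) k≡) (proj₂ dm))
    where dm = divMod-unique B i ρ ρ<B

  collectorSuccessor∋slot : ∀ i ρ → ρ < B → ∀ k → toℕ k ≡ suc (B * i + ρ) → range (r k) ∋ collectorSlot i ρ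
  collectorSuccessor∋slot i ρ ρ<B k k≡ with m≤n⇒m<n∨m≡n ρ<B
  ... | inj₁ 1+ρ<B = subst (_∋ collectorSlot i ρ)
                       (sym (range-r≡collectorRange k i (suc ρ) (trans k≡ (sym (+-suc (B * i) ρ))) 1+ρ<B))
                       (≤-refl , +-monoʳ-≤ (W * dividerBlock i) (n≤1+n (suc ρ)))
  ... | inj₂ 1+ρ≡B = subst (_∋ collectorSlot i ρ) (sym (range-r≡collectorRange k (suc i) 0 k≡B*[1+i] B≥1))
                       (m≤m+n _ _ ,
                        +-mono-≤ (*-monoʳ-≤ W (dividerBlock-mono i)) (subst (_≤ last) (sym 1+ρ≡B) B≤last))
    where
    k≡B*[1+i] : toℕ k ≡ B * suc i + 0
    k≡B*[1+i] = trans k≡ (trans (sym (+-suc (B * i) ρ)) (trans (cong (B * i +_) 1+ρ≡B) (B*i+B≡B*[1+i]+0 B i)))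

  rimT∋ : ∀ j k → CycSucc (3 * m) j k → range (t k) ∋ home (t j)
  rimT∋ j k (inj₁ k≡1+j)     = subst (λ K → transmitterRange K ∋ W * toℕ j) (sym k≡1+j)
                                 (≤-refl , ≤-trans (*-monoʳ-≤ W (n≤1+n (toℕ j))) (m≤m+n _ last))
  rimT∋ j k (inj₂ (_ , k≡0)) = subst (λ K → transmitterRange K ∋ W * toℕ j) (sym k≡0) tt

  rimC∋ : ∀ j k → CycSucc (B * m) j k → range (r k) ∋ home (r j)
  rimC∋ j k (inj₁ k≡1+j)     = collectorSuccessor∋slot (toℕ j / B) (toℕ j % B) (m%n<n (toℕ j) B) k
                                 (trans k≡1+j (cong suc (collectorIndex j)))
  rimC∋ j k (inj₂ (_ , k≡0)) =
    subst (_∋ home (r j)) (sym (range-r≡collectorRange k 0 0 (trans k≡0 (sym (b*0+0≡0 B))) B≥1)) tt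

  fence-in-range : ∀ f z → range (emb I f z) ∋ slot f
  fence-in-range (ftr k)      lu      = tt
  fence-in-range (ftr k)      lv      = range∋home (t k)
  fence-in-range (ftr k)      (lin _) = ≤-refl , ≤-refl
  fence-in-range (fco k)      lu      = tt
  fence-in-range (fco k)      lv      = range∋home (r k)
  fence-in-range (fco k)      (lin _) = ≤-refl , ≤-refl
  fence-in-range (fdiv i dv₁) lu      =
    subst (λ K → transmitterRange K ∋ dividerSlot (toℕ i)) (sym (toℕ-fromℕ< _))
      (transmitterRange∋ (dividerBlock (toℕ i)) B (≤-trans (s≤s z≤n) (m≤n+m 2 (3 * toℕ i))) B≤last)
  fence-in-range (fdiv i dv₁) lv      = ≤-refl , ≤-refl
  fence-in-range (fdiv i dv₁) (lin _) = ≤-refl , ≤-refl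
  fence-in-range (fdiv i dv₂) lu      = ≤-refl , ≤-refl
  fence-in-range (fdiv i dv₂) lv      = ≤-refl , ≤-refl
  fence-in-range (fdiv i dv₂) (lin _) = ≤-refl , ≤-refl
  fence-in-range (fdiv i dv₃) lu      = ≤-refl , ≤-refl
  fence-in-range (fdiv i dv₃) lv      =
    subst₂ _∋_ (sym (range-r≡collectorRange _ (toℕ i) (B ∸ 1) (idxB-toℕ B B≥1 i) (≤-reflexive 1+[B∸1]≡B)))
      (cong (pos (dividerBlock (toℕ i))) 1+[B∸1]≡B)
      (collectorRange∋slot (toℕ i) (B ∸ 1) (≤-reflexive 1+[B∸1]≡B))
    where
    1+[B∸1]≡B : suc (B ∸ 1) ≡ B
    1+[B∸1]≡B = m+[n∸m]≡n B≥1
  fence-in-range (fdiv i dv₃) (lin _) = ≤-refl , ≤-refl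
  fence-in-range (fspl a j)   lu      = m≤m+n _ _ , +-monoʳ-≤ (W * toℕ a) (splitterOffset≤last a j)
  fence-in-range (fspl a j)   lv      = ≤-refl , ≤-refl
  fence-in-range (fspl a j)   (lin _) = ≤-refl , ≤-refl

  pos<extent : ∀ {x y} → x < 3 * m → y ≤ last → pos x y < extent
  pos<extent {x} {y} x<3m y≤last =
    ≤-trans (s≤s (+-monoʳ-≤ (W * x) y≤last))
            (≤-trans (≤-reflexive (1+[w*x+l]≡w*[1+x] last x)) (*-monoʳ-≤ W x<3m))

  blockStart<extent : ∀ {x} → x < 3 * m → W * x < extent
  blockStart<extent x<3m = subst (_< extent) (+-identityʳ _) (pos<extent x<3m z≤n)

  dividerBlock<3m : ∀ {i} → i < m → dividerBlock i < 3 * m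
  dividerBlock<3m {i} i<m = subst (_≤ 3 * m) (sym (1+[3*i+2]≡3*[1+i] i)) (*-monoʳ-≤ 3 i<m)

  slot<extent : ∀ f → slot f < extent
  slot<extent (ftr k)    = blockStart<extent (toℕ<n k)
  slot<extent (fco k)    = pos<extent (dividerBlock<3m (m<n*o⇒m/o<n (subst (toℕ k <_) (*-comm B m) (toℕ<n k))))
                                      (≤-trans (m%n<n (toℕ k) B) B≤last)
  slot<extent (fdiv i _) = pos<extent (dividerBlock<3m (toℕ<n i)) B≤last
  slot<extent (fspl a j) = pos<extent (toℕ<n a) (splitterOffset≤last a j)

  home<extent : ∀ v → home v < extent
  home<extent cT        = ≤-trans (s≤s z≤n) (blockStart<extent (≤-trans (s≤s z≤n) (≤-trans m≥3 (m≤m+n m _))))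
  home<extent cC        = home<extent cT
  home<extent (t k)     = slot<extent (ftr k)
  home<extent (r k)     = slot<extent (fco k)
  home<extent (q a)     = blockStart<extent (toℕ<n a)
  home<extent (d i)     = slot<extent (fdiv i dv₁)
  home<extent (d' i)    = slot<extent (fdiv i dv₂)
  home<extent (l a j)   = slot<extent (fspl a j)
  home<extent (fin f _) = slot<extent f

  meet-at-home : ∀ x y → range y ∋ home x → ∃[ p ] (p < extent × range x ∋ p × range y ∋ p)
  meet-at-home x _ h = home x , home<extent x , range∋home x , h

  model : ∀ σ ch → IntervalModel (Vtx I) (GE I σ ch)
  model σ ch = record
    { extent     = extent
    ; range      = range
    ; home       = home
    ; home<      = home<extent
    ; range-home = range∋home
    ; meet       = meet
    ; candidates = candidates
    ; candidates-complete = candidates-complete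
    }
    where
    meet : ∀ x y → GE I σ ch x y → ∃[ p ] (p < extent × range x ∋ p × range y ∋ p)
    meet _ _ (rimT j k succ)   = meet-at-home (t j) (t k) (rimT∋ j k succ)
    meet _ _ (rimC j k succ)   = meet-at-home (r j) (r k) (rimC∋ j k succ)
    meet _ _ (q-cT a)          = meet-at-home (q a) cT tt
    meet _ _ (l-cC a j)        = meet-at-home (l a j) cC tt
    meet _ _ (fence f x y _)   = slot f , slot<extent f , fence-in-range f x , fence-in-range f y

lemma5p5 : ∃[ c ] ((σ : Shape) (I : Instance) →
             2 ∣ Instance.m I → 2 ∣ Instance.B I →
             (ch : FenceId I → Bool) →
             PathwidthAtMost (Vtx I) (GE I σ ch) c)
lemma5p5 = 607 , λ σ I _ _ ch →
  let open IntervalModel (Layout.model I σ ch) in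
  pathDecomposition , pathDecomposition-width 607 (Layout.length-candidates I)
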